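{- For commands $c$ and $d$ both satisfying $x\Cap\mathbf{term}=x$ and $x\parallel\mathbf{term}=x$: $(\mathbf{rely}\,r)\Cap(c\Cap d) \sqsubseteq \big((\mathbf{rely}(r\cup r_0))\Cap(\mathbf{guar}\,r_1)\Cap c\big)\parallel\big((\mathbf{rely}(r\cup r_1))\Cap(\mathbf{guar}\,r_0)\Cap d\big)$.
   Context: Shared-memory interpretation of a refinement algebra: commands are ordered by refinement $\sqsubseteq$; program steps $\pi(r)$ and environment steps $\epsilon(r)$ are atomic commands indexed by relations on states, $\pi,\epsilon$ the steps for the universal relation, $\alpha=\pi\sqcap\epsilon$ the least atomic step. Parallel $\parallel$ (identity $\mathbf{skip}=\epsilon^\omega$) and weak conjunction $\Cap$ (identity $\mathbf{chaos}=\alpha^\omega$, associative, commutative, idempotent) are abort-strict synchronisation operators, with $\pi(r_1)\parallel\epsilon(r_2)=\pi(r_1\cap r_2)$, $\epsilon(r_1)\parallel\epsilon(r_2)=\epsilon(r_1\cap r_2)$, $\pi(r_1)\parallel\pi(r_2)=\top$, and the interchange axiom $(c_0\parallel d_0)\Cap(c_1\parallel d_1)\sqsubseteq(c_0\Cap c_1)\parallel(d_0\Cap d_1)$. Definitions: $\mathbf{term}=\alpha^\star;\epsilon^\omega$, $\mathbf{guar}\,g=(\pi(g)\sqcap\epsilon)^\omega$, $\mathbf{rely}\,r=(\pi\sqcap\epsilon(r)\sqcap\epsilon(\overline r);\bot)^\omega$ with $\overline r$ the complement of $r$. -}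

module Defs where

open import Data.Bool using (Bool; true; false; _∧_; _∨_; not)
open import Data.Product using (Σ; Σ-syntax; _×_; _,_; proj₁; ∃; ∃-syntax)
open import Relation.Binary.PropositionalEquality using (_≡_)

-- Relations on states (binary relations, as Boolean-valued predicates
-- on pairs of states, so that complement is the classical complement).

Rel : Set → Set
Rel St = St → St → Bool

module _ {St : Set} where
  infixr 6 _∪ᵣ_
  infixr 7 _∩ᵣ_
  ∅ᵣ : Rel St
  ∅ᵣ _ _ = false

  univᵣ : Rel St
  univᵣ _ _ = true

  _∪ᵣ_ : Rel St → Rel St → Rel St
  (r₁ ∪ᵣ r₂) σ σ′ = r₁ σ σ′ ∨ r₂ σ σ′

  _∩ᵣ_ : Rel St → Rel St → Rel St
  (r₁ ∩ᵣ r₂) σ σ′ = r₁ σ σ′ ∧ r₂ σ σ′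

  ∁ᵣ : Rel St → Rel St
  ∁ᵣ r σ σ′ = not (r σ σ′)

  _⊆ᵣ_ : Rel St → Rel St → Set
  r₁ ⊆ᵣ r₂ = ∀ σ σ′ → r₁ σ σ′ ≡ true → r₂ σ σ′ ≡ true


-- Core: commands form a complete lattice under refinement ⊑
-- (c ⊑ d : "c is refined by d"; ⊓ = nondeterministic choice = meet,
-- ⊥ = abort, ⊤ = infeasible/magic), with sequential composition and the
-- atomic program steps π(r) and environment steps ε(r) of the
-- shared-memory interpretation.

record Core (St : Set) : Set₁ where
  infix  4 _⊑_
  infixr 9 _⨾_
  infixr 8 _⊔_
  infixr 7 _⊓_
  field
    Cmd : Set
    _⊑_ : Cmd → Cmd → Set
    ⊑-refl    : ∀ {c} → c ⊑ c
    ⊑-trans   : ∀ {c d e} → c ⊑ d → d ⊑ e → c ⊑ e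
    ⊑-antisym : ∀ {c d} → c ⊑ d → d ⊑ c → c ≡ d

    ⨅ : {I : Set} → (I → Cmd) → Cmd
    ⨅-lb  : ∀ {I} (f : I → Cmd) i → ⨅ f ⊑ f i
    ⨅-glb : ∀ {I} (f : I → Cmd) x → (∀ i → x ⊑ f i) → x ⊑ ⨅ f
    ⨆ : {I : Set} → (I → Cmd) → Cmd
    ⨆-ub  : ∀ {I} (f : I → Cmd) i → f i ⊑ ⨆ f
    ⨆-lub : ∀ {I} (f : I → Cmd) x → (∀ i → f i ⊑ x) → ⨆ f ⊑ x

    _⊓_ : Cmd → Cmd → Cmd
    ⊓-lbˡ : ∀ c d → c ⊓ d ⊑ c
    ⊓-lbʳ : ∀ c d → c ⊓ d ⊑ d
    ⊓-glb : ∀ {c d x} → x ⊑ c → x ⊑ d → x ⊑ c ⊓ d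
    _⊔_ : Cmd → Cmd → Cmd
    ⊔-ubˡ : ∀ c d → c ⊑ c ⊔ d
    ⊔-ubʳ : ∀ c d → d ⊑ c ⊔ d
    ⊔-lub : ∀ {c d x} → c ⊑ x → d ⊑ x → c ⊔ d ⊑ x
    ⊤ : Cmd
    ⊤-max : ∀ c → c ⊑ ⊤
    ⊥ : Cmd
    ⊥-min : ∀ c → ⊥ ⊑ c

    nil : Cmd
    _⨾_ : Cmd → Cmd → Cmd
    ⨾-assoc : ∀ c d e → (c ⨾ d) ⨾ e ≡ c ⨾ (d ⨾ e)
    ⨾-identityˡ : ∀ c → nil ⨾ c ≡ c
    ⨾-identityʳ : ∀ c → c ⨾ nil ≡ c
    ⊥-⨾ : ∀ c → ⊥ ⨾ c ≡ ⊥
    -- left argument: distributes over arbitrary choice (incl. ⊤ ⨾ d = ⊤)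
    ⨅-⨾ : ∀ {I} (f : I → Cmd) d → ⨅ f ⨾ d ≡ ⨅ (λ i → f i ⨾ d)
    ⨾-⊓ : ∀ c d e → c ⨾ (d ⊓ e) ≡ (c ⨾ d) ⊓ (c ⨾ e)

    π : Rel St → Cmd
    ε : Rel St → Cmd
    π-mono : ∀ {r₁ r₂} → r₁ ⊆ᵣ r₂ → π r₂ ⊑ π r₁
    ε-mono : ∀ {r₁ r₂} → r₁ ⊆ᵣ r₂ → ε r₂ ⊑ ε r₁
    π-∪ : ∀ r₁ r₂ → π (r₁ ∪ᵣ r₂) ≡ π r₁ ⊓ π r₂
    ε-∪ : ∀ r₁ r₂ → ε (r₁ ∪ᵣ r₂) ≡ ε r₁ ⊓ ε r₂
    π-∩ : ∀ r₁ r₂ → π (r₁ ∩ᵣ r₂) ≡ π r₁ ⊔ π r₂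
    ε-∩ : ∀ r₁ r₂ → ε (r₁ ∩ᵣ r₂) ≡ ε r₁ ⊔ ε r₂
    π-∅ : π ∅ᵣ ≡ ⊤
    ε-∅ : ε ∅ᵣ ≡ ⊤
    π⊔ε : ∀ r₁ r₂ → π r₁ ⊔ ε r₂ ≡ ⊤

module Derived {St : Set} (C : Core St) where
  open Core C

  Atomic : Cmd → Set
  Atomic a = Σ[ r₁ ∈ Rel St ] Σ[ r₂ ∈ Rel St ] a ≡ π r₁ ⊓ ε r₂

  πᵤ εᵤ α : Cmd
  πᵤ = π univᵣ
  εᵤ = ε univᵣ
  α = πᵤ ⊓ εᵤ

  -- c^ω = μ x . nil ⊓ c ⨾ x  (least fixed point w.r.t. ⊑)
  _^ω : Cmd → Cmd
  c ^ω = ⨅ {Σ[ x ∈ Cmd ] (nil ⊓ c ⨾ x ⊑ x)} proj₁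

  -- c^⋆ = ν x . nil ⊓ c ⨾ x  (greatest fixed point w.r.t. ⊑)
  _^⋆ : Cmd → Cmd
  c ^⋆ = ⨆ {Σ[ x ∈ Cmd ] (x ⊑ nil ⊓ c ⨾ x)} proj₁

  infix 10 _^ω _^⋆

  skip chaos term : Cmd
  skip  = εᵤ ^ω
  chaos = α ^ω
  term  = (α ^⋆) ⨾ (εᵤ ^ω)

  guar : Rel St → Cmd
  guar g = (π g ⊓ εᵤ) ^ω

  rely : Rel St → Cmd
  rely r = (πᵤ ⊓ ε r ⊓ ε (∁ᵣ r) ⨾ ⊥) ^ω

record IsSyncOp {St : Set} (C : Core St) (_⊗_ : Core.Cmd C → Core.Cmd C → Core.Cmd C)
                (e : Core.Cmd C) : Set₁ where
  open Core C
  open Derived C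
  field
    assoc    : ∀ c d f → (c ⊗ d) ⊗ f ≡ c ⊗ (d ⊗ f)
    comm     : ∀ c d → c ⊗ d ≡ d ⊗ c
    identity : ∀ c → c ⊗ e ≡ c
    -- distributes over non-empty arbitrary choice
    ⨅-distrib : ∀ {I} (i : I) (f : I → Cmd) d → ⨅ f ⊗ d ≡ ⨅ (λ j → f j ⊗ d)
    abort-strict : ∀ c → ⊥ ⊗ c ≡ ⊥
    atomic-sync : ∀ a b c d → Atomic a → Atomic b → (a ⨾ c) ⊗ (b ⨾ d) ≡ (a ⊗ b) ⨾ (c ⊗ d)
    atomic-nil  : ∀ a c → Atomic a → (a ⨾ c) ⊗ nil ≡ ⊤
    nil-nil     : nil ⊗ nil ≡ nil
    atomic-iter : ∀ a b → Atomic a → Atomic b → (a ^ω) ⊗ (b ^ω) ≡ (a ⊗ b) ^ω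
    seq-interchange : ∀ c₀ c₁ d₀ d₁ → (c₀ ⨾ c₁) ⊗ (d₀ ⨾ d₁) ⊑ (c₀ ⊗ d₀) ⨾ (c₁ ⊗ d₁)

record Algebra (St : Set) : Set₁ where
  field core : Core St
  open Core core public
  open Derived core public
  infixr 5 _∥_
  infixr 6 _⋒_
  field
    _∥_ : Cmd → Cmd → Cmd
    _⋒_ : Cmd → Cmd → Cmd
    ∥-sync : IsSyncOp core _∥_ skip
    ⋒-sync : IsSyncOp core _⋒_ chaos
    π∥ε : ∀ r₁ r₂ → π r₁ ∥ ε r₂ ≡ π (r₁ ∩ᵣ r₂)
    ε∥ε : ∀ r₁ r₂ → ε r₁ ∥ ε r₂ ≡ ε (r₁ ∩ᵣ r₂)
    π∥π : ∀ r₁ r₂ → π r₁ ∥ π r₂ ≡ ⊤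
    π⋒π : ∀ r₁ r₂ → π r₁ ⋒ π r₂ ≡ π (r₁ ∩ᵣ r₂)
    ε⋒ε : ∀ r₁ r₂ → ε r₁ ⋒ ε r₂ ≡ ε (r₁ ∩ᵣ r₂)
    π⋒ε : ∀ r₁ r₂ → π r₁ ⋒ ε r₂ ≡ ⊤
    ⋒-idem : ∀ c → c ⋒ c ≡ c
    interchange : ∀ c₀ c₁ d₀ d₁ → (c₀ ∥ d₀) ⋒ (c₁ ∥ d₁) ⊑ (c₀ ⋒ c₁) ∥ (d₀ ⋒ d₁)

module Submission where

open import Data.Bool using (Bool; true; false; _∨_; not; if_then_else_)
open import Data.Bool.Properties using (∧-conicalˡ; ∧-conicalʳ; ∨-zeroʳ; ∨-inverseʳ)
open import Data.Product using (_,_; proj₁)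
open import Function using (_∘_)
open import Relation.Binary.Bundles using (Preorder)
open import Relation.Binary.PropositionalEquality
  using (_≡_; refl; sym; trans; cong; cong₂; subst; isEquivalence; module ≡-Reasoning)
import Relation.Binary.Reasoning.Preorder as PreorderReasoning

open import Defs

-- Since rely r is the least fixed point of x ↦ nil ⊓ (πᵤ ⊓ ε r ⊓ ε (∁ r) ⨾ ⊥) ⨾ x,
-- it suffices that X = (rely (r ∪ r₀) ⋒ guar r₁) ∥ (rely (r ∪ r₁) ⋒ guar r₀) is a
-- prefixed point. Unfold each component of X by one atomic step and multiply out:
-- whenever one side takes a program step, its guarantee lies inside the other
-- side's rely, so the joint step is an arbitrary atomic step; a joint environment
-- step outside r leaves one of the two relies, and that side aborts, as rely r
-- permits. Finally c ⋒ d ⊑ c ∥ d for commands absorbing term, and the interchange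
-- law distributes X ⋒ (c ∥ d) over the two components.

module _ {St : Set} where

  ⊆ᵣ-trans : {r s t : Rel St} → r ⊆ᵣ s → s ⊆ᵣ t → r ⊆ᵣ t
  ⊆ᵣ-trans r⊆s s⊆t σ σ′ = s⊆t σ σ′ ∘ r⊆s σ σ′

  ⊆ᵣ-univᵣ : {r : Rel St} → r ⊆ᵣ univᵣ
  ⊆ᵣ-univᵣ _ _ _ = refl

  ∩ᵣ-⊆ˡ : {r s : Rel St} → (r ∩ᵣ s) ⊆ᵣ r
  ∩ᵣ-⊆ˡ {r} {s} σ σ′ = ∧-conicalˡ (r σ σ′) (s σ σ′)

  ∩ᵣ-⊆ʳ : {r s : Rel St} → (r ∩ᵣ s) ⊆ᵣ s
  ∩ᵣ-⊆ʳ {r} {s} σ σ′ = ∧-conicalʳ (r σ σ′) (s σ σ′)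

  ∪ᵣ-⊆ˡ : {r s : Rel St} → r ⊆ᵣ (r ∪ᵣ s)
  ∪ᵣ-⊆ˡ {s = s} σ σ′ rσσ′ = cong (_∨ s σ σ′) rσσ′

  ∪ᵣ-⊆ʳ : {r s : Rel St} → s ⊆ᵣ (r ∪ᵣ s)
  ∪ᵣ-⊆ʳ {r} σ σ′ sσσ′ = trans (cong (r σ σ′ ∨_) sσσ′) (∨-zeroʳ (r σ σ′))

  univᵣ⊆∪∁ᵣ : {r : Rel St} → univᵣ ⊆ᵣ (r ∪ᵣ ∁ᵣ r)
  univᵣ⊆∪∁ᵣ {r} σ σ′ _ = ∨-inverseʳ (r σ σ′)

  ∁ᵣ-antitone : {r s : Rel St} → r ⊆ᵣ s → ∁ᵣ s ⊆ᵣ ∁ᵣ r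
  ∁ᵣ-antitone {r} {s} r⊆s σ σ′ = not-antitone (r⊆s σ σ′)
    where
    not-antitone : ∀ {x y} → (x ≡ true → y ≡ true) → not y ≡ true → not x ≡ true
    not-antitone {false}         _    _  = refl
    not-antitone {true} {false}  x⇒y  _  = x⇒y refl
    not-antitone {true} {true}   _    ()

  ∩ᵣ-∁ᵣ-empty : {r s : Rel St} → r ⊆ᵣ s → (r ∩ᵣ ∁ᵣ s) ⊆ᵣ ∅ᵣ
  ∩ᵣ-∁ᵣ-empty {r} {s} r⊆s σ σ′ r∩∁s =
    subst (λ b → not b ≡ true) (r⊆s σ σ′ (∩ᵣ-⊆ˡ {r} {∁ᵣ s} σ σ′ r∩∁s))
                               (∩ᵣ-⊆ʳ {r} {∁ᵣ s} σ σ′ r∩∁s)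

module Laws {St : Set} (A : Algebra St) where
  open Algebra A

  ⊑-reflexive : ∀ {x y} → x ≡ y → x ⊑ y
  ⊑-reflexive refl = ⊑-refl

  ⊑-preorder : Preorder _ _ _
  ⊑-preorder = record
    { Carrier    = Cmd
    ; _≈_        = _≡_
    ; _≲_        = _⊑_
    ; isPreorder = record
      { isEquivalence = isEquivalence ; reflexive = ⊑-reflexive ; trans = ⊑-trans } }

  module ⊑-Reasoning = PreorderReasoning ⊑-preorder

  ⊑-⊤ : ∀ {x y} → y ≡ ⊤ → x ⊑ y
  ⊑-⊤ {x} y≡⊤ = ⊑-trans (⊤-max x) (⊑-reflexive (sym y≡⊤))

  ⊓-mono : ∀ {a a′ b b′} → a ⊑ a′ → b ⊑ b′ → a ⊓ b ⊑ a′ ⊓ b′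
  ⊓-mono {a} {a′} {b} {b′} a⊑a′ b⊑b′ =
    ⊓-glb (⊑-trans (⊓-lbˡ a b) a⊑a′) (⊑-trans (⊓-lbʳ a b) b⊑b′)

  ⊑⇒≡⊓ : ∀ {x y} → x ⊑ y → x ≡ x ⊓ y
  ⊑⇒≡⊓ {x} {y} x⊑y = ⊑-antisym (⊓-glb ⊑-refl x⊑y) (⊓-lbˡ x y)

  ⊓-assoc : ∀ x y z → (x ⊓ y) ⊓ z ≡ x ⊓ (y ⊓ z)
  ⊓-assoc x y z = ⊑-antisym
    (⊓-glb (⊑-trans (⊓-lbˡ _ z) (⊓-lbˡ x y)) (⊓-mono (⊓-lbʳ x y) ⊑-refl))
    (⊓-glb (⊓-mono ⊑-refl (⊓-lbˡ y z)) (⊑-trans (⊓-lbʳ x _) (⊓-lbʳ y z)))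

  ⨅-Bool : (f : Bool → Cmd) → ⨅ f ≡ f true ⊓ f false
  ⨅-Bool f = ⊑-antisym
    (⊓-glb (⨅-lb f true) (⨅-lb f false))
    (⨅-glb f _ λ { true → ⊓-lbˡ _ _ ; false → ⊓-lbʳ _ _ })

  ⊓-homo⇒mono : (f : Cmd → Cmd) → (∀ x y → f (x ⊓ y) ≡ f x ⊓ f y) →
                ∀ {x y} → x ⊑ y → f x ⊑ f y
  ⊓-homo⇒mono f homo {x} {y} x⊑y = begin
    f x          ≡⟨ cong f (⊑⇒≡⊓ x⊑y) ⟩
    f (x ⊓ y)    ≡⟨ homo x y ⟩
    f x ⊓ f y    ≲⟨ ⊓-lbʳ _ _ ⟩
    f y          ∎
    where open ⊑-Reasoning

  ⨾-distribʳ-⊓ : ∀ x y z → (x ⊓ y) ⨾ z ≡ x ⨾ z ⊓ y ⨾ z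
  ⨾-distribʳ-⊓ x y z = begin
    (x ⊓ y) ⨾ z                                  ≡⟨ cong (_⨾ z) (sym (⨅-Bool choice)) ⟩
    ⨅ choice ⨾ z                                 ≡⟨ ⨅-⨾ choice z ⟩
    ⨅ (λ b → choice b ⨾ z)                       ≡⟨ ⨅-Bool _ ⟩
    x ⨾ z ⊓ y ⨾ z                                ∎
    where
    open ≡-Reasoning
    choice : Bool → Cmd
    choice b = if b then x else y

  ⨾-monoˡ : ∀ {x y z} → x ⊑ y → x ⨾ z ⊑ y ⨾ z
  ⨾-monoˡ {z = z} = ⊓-homo⇒mono (_⨾ z) (λ x y → ⨾-distribʳ-⊓ x y z)

  ⨾-monoʳ : ∀ {x y z} → x ⊑ y → z ⨾ x ⊑ z ⨾ y
  ⨾-monoʳ {z = z} = ⊓-homo⇒mono (z ⨾_) (⨾-⊓ z)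

  ⨾-mono : ∀ {a a′ b b′} → a ⊑ a′ → b ⊑ b′ → a ⨾ b ⊑ a′ ⨾ b′
  ⨾-mono a⊑a′ b⊑b′ = ⊑-trans (⨾-monoˡ a⊑a′) (⨾-monoʳ b⊑b′)

  ^ω-induction : ∀ {c x} → nil ⊓ c ⨾ x ⊑ x → c ^ω ⊑ x
  ^ω-induction {x = x} prefixed = ⨅-lb proj₁ (x , prefixed)

  ^ω-fold : ∀ c → nil ⊓ c ⨾ c ^ω ⊑ c ^ω
  ^ω-fold c = ⨅-glb proj₁ _ λ { (x , prefixed) →
    ⊑-trans (⊓-mono ⊑-refl (⨾-monoʳ (^ω-induction prefixed))) prefixed }

  module Sync {_⊗_ : Cmd → Cmd → Cmd} {e : Cmd} (S : IsSyncOp core _⊗_ e) where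
    open IsSyncOp S

    ⊗-distribʳ-⊓ : ∀ x y z → (x ⊓ y) ⊗ z ≡ x ⊗ z ⊓ y ⊗ z
    ⊗-distribʳ-⊓ x y z = begin
      (x ⊓ y) ⊗ z                ≡⟨ cong (_⊗ z) (sym (⨅-Bool choice)) ⟩
      ⨅ choice ⊗ z               ≡⟨ ⨅-distrib true choice z ⟩
      ⨅ (λ b → choice b ⊗ z)     ≡⟨ ⨅-Bool _ ⟩
      x ⊗ z ⊓ y ⊗ z              ∎
      where
      open ≡-Reasoning
      choice : Bool → Cmd
      choice b = if b then x else y

    ⊗-distribˡ-⊓ : ∀ x y z → z ⊗ (x ⊓ y) ≡ z ⊗ x ⊓ z ⊗ y
    ⊗-distribˡ-⊓ x y z =
      trans (comm z _) (trans (⊗-distribʳ-⊓ x y z) (cong₂ _⊓_ (comm x z) (comm y z)))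

    ⊑-⊓⊗ : ∀ {w x y z} → w ⊑ x ⊗ z → w ⊑ y ⊗ z → w ⊑ (x ⊓ y) ⊗ z
    ⊑-⊓⊗ {x = x} {y} {z} w⊑x⊗z w⊑y⊗z =
      ⊑-trans (⊓-glb w⊑x⊗z w⊑y⊗z) (⊑-reflexive (sym (⊗-distribʳ-⊓ x y z)))

    ⊑-⊗⊓ : ∀ {w x y z} → w ⊑ z ⊗ x → w ⊑ z ⊗ y → w ⊑ z ⊗ (x ⊓ y)
    ⊑-⊗⊓ {x = x} {y} {z} w⊑z⊗x w⊑z⊗y =
      ⊑-trans (⊓-glb w⊑z⊗x w⊑z⊗y) (⊑-reflexive (sym (⊗-distribˡ-⊓ x y z)))

    ⊗-mono : ∀ {a a′ b b′} → a ⊑ a′ → b ⊑ b′ → a ⊗ b ⊑ a′ ⊗ b′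
    ⊗-mono {a} {a′} {b} {b′} a⊑a′ b⊑b′ = ⊑-trans
      (⊓-homo⇒mono (_⊗ b) (λ x y → ⊗-distribʳ-⊓ x y b) a⊑a′)
      (⊓-homo⇒mono (a′ ⊗_) (λ x y → ⊗-distribˡ-⊓ x y a′) b⊑b′)

    nil-⊗-atomic : ∀ {a} c → Atomic a → nil ⊗ (a ⨾ c) ≡ ⊤
    nil-⊗-atomic {a} c atomic = trans (comm nil (a ⨾ c)) (atomic-nil a c atomic)

    ⨾-⊗-atomic : ∀ {a b c d s t} → Atomic a → Atomic b →
                 s ⊑ a ⊗ b → t ⊑ c ⊗ d → s ⨾ t ⊑ (a ⨾ c) ⊗ (b ⨾ d)
    ⨾-⊗-atomic {a} {b} {c} {d} atomic-a atomic-b s⊑a⊗b t⊑c⊗d = ⊑-trans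
      (⨾-mono s⊑a⊗b t⊑c⊗d) (⊑-reflexive (sym (atomic-sync a b c d atomic-a atomic-b)))

  open Sync ∥-sync public using () renaming
    (⊑-⊓⊗ to ⊑-⊓∥; ⊑-⊗⊓ to ⊑-∥⊓; ⊗-mono to ∥-mono; nil-⊗-atomic to nil-∥-atomic;
     ⨾-⊗-atomic to ⨾-∥-atomic)
  open Sync ⋒-sync public using () renaming
    (⊑-⊓⊗ to ⊑-⊓⋒; ⊑-⊗⊓ to ⊑-⋒⊓; ⊗-mono to ⋒-mono; nil-⊗-atomic to nil-⋒-atomic;
     ⨾-⊗-atomic to ⨾-⋒-atomic)
  open IsSyncOp ∥-sync public using () renaming
    (comm to ∥-comm; atomic-nil to atomic-∥-nil; nil-nil to nil-∥-nil)
  open IsSyncOp ⋒-sync public using () renaming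
    (comm to ⋒-comm; assoc to ⋒-assoc; atomic-nil to atomic-⋒-nil; nil-nil to nil-⋒-nil)

  π⊓ε-atomic : ∀ p e → Atomic (π p ⊓ ε e)
  π⊓ε-atomic p e = p , e , refl

  ε-atomic : ∀ e → Atomic (ε e)
  ε-atomic e = ∅ᵣ , e , ⊑-antisym
    (⊓-glb (⊑-⊤ π-∅) ⊑-refl)
    (⊓-lbʳ _ _)

  α⊑π⊓ε : ∀ {p e} → α ⊑ π p ⊓ ε e
  α⊑π⊓ε = ⊓-mono (π-mono ⊆ᵣ-univᵣ) (ε-mono ⊆ᵣ-univᵣ)

  ε⊑π⊓ε : ∀ {p e e′} → p ⊆ᵣ ∅ᵣ → e′ ⊆ᵣ e → ε e ⊑ π p ⊓ ε e′
  ε⊑π⊓ε p⊆∅ e′⊆e = ⊓-glb (⊑-trans (⊑-⊤ π-∅) (π-mono p⊆∅)) (ε-mono e′⊆e)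

  π⊓ε-⋒-π⊓ε : ∀ a b c d → π (a ∩ᵣ c) ⊓ ε (b ∩ᵣ d) ⊑ (π a ⊓ ε b) ⋒ (π c ⊓ ε d)
  π⊓ε-⋒-π⊓ε a b c d = ⊑-⊓⋒
    (⊑-⋒⊓ (⊑-trans (⊓-lbˡ _ _) (⊑-reflexive (sym (π⋒π a c)))) (⊑-⊤ (π⋒ε a d)))
    (⊑-⋒⊓ (⊑-⊤ (trans (⋒-comm (ε b) (π c)) (π⋒ε c b)))
          (⊑-trans (⊓-lbʳ _ _) (⊑-reflexive (sym (ε⋒ε b d)))))

  ε-⋒-π⊓ε : ∀ p e f → ε (e ∩ᵣ f) ⊑ ε e ⋒ (π p ⊓ ε f)
  ε-⋒-π⊓ε p e f = ⊑-⋒⊓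
    (⊑-⊤ (trans (⋒-comm (ε e) (π p)) (π⋒ε p e)))
    (⊑-reflexive (sym (ε⋒ε e f)))

  π⊓ε-∥-ε : ∀ a b d → π (a ∩ᵣ d) ⊓ ε (b ∩ᵣ d) ⊑ (π a ⊓ ε b) ∥ ε d
  π⊓ε-∥-ε a b d = ⊑-⊓∥
    (⊑-trans (⊓-lbˡ _ _) (⊑-reflexive (sym (π∥ε a d))))
    (⊑-trans (⊓-lbʳ _ _) (⊑-reflexive (sym (ε∥ε b d))))

  α⊑α∥α : α ⊑ α ∥ α
  α⊑α∥α = ⊑-⊓∥
    (⊑-∥⊓ (⊑-⊤ (π∥π univᵣ univᵣ)) (⊑-trans (⊓-lbˡ _ _) (⊑-reflexive (sym (π∥ε univᵣ univᵣ)))))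
    (⊑-∥⊓ (⊑-trans (⊓-lbˡ _ _) (⊑-reflexive (sym (trans (∥-comm εᵤ πᵤ) (π∥ε univᵣ univᵣ)))))
          (⊑-trans (⊓-lbʳ _ _) (⊑-reflexive (sym (ε∥ε univᵣ univᵣ)))))

  ρ : Rel St → Cmd
  ρ r = πᵤ ⊓ ε r ⊓ ε (∁ᵣ r) ⨾ ⊥

  ρ-⨾ : ∀ r c → ρ r ⨾ c ≡ (πᵤ ⊓ ε r) ⨾ c ⊓ ε (∁ᵣ r) ⨾ ⊥
  ρ-⨾ r c = begin
    (πᵤ ⊓ ε r ⊓ ε (∁ᵣ r) ⨾ ⊥) ⨾ c       ≡⟨ cong (_⨾ c) (sym (⊓-assoc πᵤ (ε r) _)) ⟩
    ((πᵤ ⊓ ε r) ⊓ ε (∁ᵣ r) ⨾ ⊥) ⨾ c     ≡⟨ ⨾-distribʳ-⊓ _ _ c ⟩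
    (πᵤ ⊓ ε r) ⨾ c ⊓ (ε (∁ᵣ r) ⨾ ⊥) ⨾ c ≡⟨ cong ((πᵤ ⊓ ε r) ⨾ c ⊓_) (⨾-assoc (ε (∁ᵣ r)) ⊥ c) ⟩
    (πᵤ ⊓ ε r) ⨾ c ⊓ ε (∁ᵣ r) ⨾ ⊥ ⨾ c   ≡⟨ cong (λ x → (πᵤ ⊓ ε r) ⨾ c ⊓ ε (∁ᵣ r) ⨾ x) (⊥-⨾ c) ⟩
    (πᵤ ⊓ ε r) ⨾ c ⊓ ε (∁ᵣ r) ⨾ ⊥       ∎
    where open ≡-Reasoning

  ρ⊑α : ∀ r → ρ r ⊑ α
  ρ⊑α r = ⊓-mono ⊑-refl (begin
    ε r ⊓ ε (∁ᵣ r) ⨾ ⊥     ≲⟨ ⊓-mono ⊑-refl (⨾-monoʳ (⊥-min nil)) ⟩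
    ε r ⊓ ε (∁ᵣ r) ⨾ nil   ≡⟨ cong (ε r ⊓_) (⨾-identityʳ _) ⟩
    ε r ⊓ ε (∁ᵣ r)         ≡⟨ sym (ε-∪ r (∁ᵣ r)) ⟩
    ε (r ∪ᵣ ∁ᵣ r)          ≲⟨ ε-mono (univᵣ⊆∪∁ᵣ {r = r}) ⟩
    εᵤ                     ∎)
    where open ⊑-Reasoning

  rely⋒guar-unfold : ∀ r g →
    nil ⊓ (π g ⊓ ε r) ⨾ (rely r ⋒ guar g) ⊓ ε (∁ᵣ r) ⨾ ⊥ ⊑ rely r ⋒ guar g
  rely⋒guar-unfold r g = begin
      nil ⊓ (π g ⊓ ε r) ⨾ (rely r ⋒ guar g) ⊓ ε (∁ᵣ r) ⨾ ⊥
    ≲⟨ stepwise ⟩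
      (nil ⊓ (πᵤ ⊓ ε r) ⨾ rely r ⊓ ε (∁ᵣ r) ⨾ ⊥) ⋒ (nil ⊓ (π g ⊓ εᵤ) ⨾ guar g)
    ≡⟨ cong (λ x → (nil ⊓ x) ⋒ (nil ⊓ (π g ⊓ εᵤ) ⨾ guar g)) (sym (ρ-⨾ r (rely r))) ⟩
      (nil ⊓ ρ r ⨾ rely r) ⋒ (nil ⊓ (π g ⊓ εᵤ) ⨾ guar g)
    ≲⟨ ⋒-mono (^ω-fold (ρ r)) (^ω-fold (π g ⊓ εᵤ)) ⟩
      rely r ⋒ guar g
    ∎
    where
    open ⊑-Reasoning
    U : Cmd
    U = nil ⊓ (π g ⊓ ε r) ⨾ (rely r ⋒ guar g) ⊓ ε (∁ᵣ r) ⨾ ⊥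

    step-step : U ⊑ ((πᵤ ⊓ ε r) ⨾ rely r) ⋒ ((π g ⊓ εᵤ) ⨾ guar g)
    step-step = ⊑-trans (⊑-trans (⊓-lbʳ _ _) (⊓-lbˡ _ _))
      (⨾-⋒-atomic (π⊓ε-atomic univᵣ r) (π⊓ε-atomic g univᵣ)
        (⊑-trans (⊓-mono ⊑-refl (ε-mono (∩ᵣ-⊆ˡ {r = r}))) (π⊓ε-⋒-π⊓ε univᵣ r g univᵣ))
        ⊑-refl)

    abort-step : U ⊑ (ε (∁ᵣ r) ⨾ ⊥) ⋒ ((π g ⊓ εᵤ) ⨾ guar g)
    abort-step = ⊑-trans (⊑-trans (⊓-lbʳ _ _) (⊓-lbʳ _ _))
      (⨾-⋒-atomic (ε-atomic (∁ᵣ r)) (π⊓ε-atomic g univᵣ)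
        (⊑-trans (ε-mono (∩ᵣ-⊆ˡ {r = ∁ᵣ r})) (ε-⋒-π⊓ε g (∁ᵣ r) univᵣ))
        (⊥-min _))

    stepwise : U ⊑ (nil ⊓ (πᵤ ⊓ ε r) ⨾ rely r ⊓ ε (∁ᵣ r) ⨾ ⊥) ⋒ (nil ⊓ (π g ⊓ εᵤ) ⨾ guar g)
    stepwise = ⊑-⊓⋒
      (⊑-⋒⊓ (⊑-trans (⊓-lbˡ _ _) (⊑-reflexive (sym nil-⋒-nil)))
            (⊑-⊤ (nil-⋒-atomic _ (π⊓ε-atomic g univᵣ))))
      (⊑-⊓⋒
        (⊑-⋒⊓ (⊑-⊤ (atomic-⋒-nil _ _ (π⊓ε-atomic univᵣ r))) step-step)
        (⊑-⋒⊓ (⊑-⊤ (atomic-⋒-nil _ _ (ε-atomic (∁ᵣ r)))) abort-step))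

  rely-split : ∀ r r₀ r₁ →
    rely r ⊑ (rely (r ∪ᵣ r₀) ⋒ guar r₁) ∥ (rely (r ∪ᵣ r₁) ⋒ guar r₀)
  rely-split r r₀ r₁ = ^ω-induction (begin
      nil ⊓ ρ r ⨾ (A₀ ∥ A₁)
    ≲⟨ stepwise ⟩
      (nil ⊓ (π r₁ ⊓ ε q₀) ⨾ A₀ ⊓ ε (∁ᵣ q₀) ⨾ ⊥) ∥ (nil ⊓ (π r₀ ⊓ ε q₁) ⨾ A₁ ⊓ ε (∁ᵣ q₁) ⨾ ⊥)
    ≲⟨ ∥-mono (rely⋒guar-unfold q₀ r₁) (rely⋒guar-unfold q₁ r₀) ⟩
      A₀ ∥ A₁
    ∎)
    where
    open ⊑-Reasoning
    q₀ q₁ : Rel St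
    q₀ = r ∪ᵣ r₀
    q₁ = r ∪ᵣ r₁
    A₀ A₁ L : Cmd
    A₀ = rely q₀ ⋒ guar r₁
    A₁ = rely q₁ ⋒ guar r₀
    L = nil ⊓ ρ r ⨾ (A₀ ∥ A₁)

    L⊑nil : L ⊑ nil ∥ nil
    L⊑nil = ⊑-trans (⊓-lbˡ _ _) (⊑-reflexive (sym nil-∥-nil))

    L⊑α⨾ : L ⊑ α ⨾ (A₀ ∥ A₁)
    L⊑α⨾ = ⊑-trans (⊓-lbʳ _ _) (⨾-monoˡ (ρ⊑α r))

    L⊑abort : L ⊑ ε (∁ᵣ r) ⨾ ⊥
    L⊑abort = ⊑-trans (⊓-lbʳ _ _) (⊑-trans (⊑-reflexive (ρ-⨾ r (A₀ ∥ A₁))) (⊓-lbʳ _ _))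

    -- Program steps guaranteeing s never violate the other side's rely r ∪ s,
    -- so only the joint environment step, which lies outside r, remains.
    abort-∥ : ∀ s t → ε (∁ᵣ r) ⊑ (π s ⊓ ε (r ∪ᵣ t)) ∥ ε (∁ᵣ (r ∪ᵣ s))
    abort-∥ s t = ⊑-trans
      (ε⊑π⊓ε (∩ᵣ-∁ᵣ-empty (∪ᵣ-⊆ʳ {r = r}))
             (⊆ᵣ-trans (∩ᵣ-⊆ʳ {r = r ∪ᵣ t}) (∁ᵣ-antitone (∪ᵣ-⊆ˡ {r = r} {s}))))
      (π⊓ε-∥-ε s (r ∪ᵣ t) (∁ᵣ (r ∪ᵣ s)))

    step-step : L ⊑ ((π r₁ ⊓ ε q₀) ⨾ A₀) ∥ ((π r₀ ⊓ ε q₁) ⨾ A₁)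
    step-step = ⊑-trans L⊑α⨾ (⨾-∥-atomic (π⊓ε-atomic r₁ q₀) (π⊓ε-atomic r₀ q₁)
      (⊑-trans α⊑α∥α (∥-mono α⊑π⊓ε α⊑π⊓ε)) ⊑-refl)

    step-abort : L ⊑ ((π r₁ ⊓ ε q₀) ⨾ A₀) ∥ (ε (∁ᵣ q₁) ⨾ ⊥)
    step-abort = ⊑-trans L⊑abort (⨾-∥-atomic (π⊓ε-atomic r₁ q₀) (ε-atomic (∁ᵣ q₁))
      (abort-∥ r₁ r₀) (⊥-min _))

    abort-step : L ⊑ (ε (∁ᵣ q₀) ⨾ ⊥) ∥ ((π r₀ ⊓ ε q₁) ⨾ A₁)
    abort-step = ⊑-trans L⊑abort (⨾-∥-atomic (ε-atomic (∁ᵣ q₀)) (π⊓ε-atomic r₀ q₁)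
      (⊑-trans (abort-∥ r₀ r₁) (⊑-reflexive (∥-comm _ _))) (⊥-min _))

    abort-abort : L ⊑ (ε (∁ᵣ q₀) ⨾ ⊥) ∥ (ε (∁ᵣ q₁) ⨾ ⊥)
    abort-abort = ⊑-trans L⊑abort (⨾-∥-atomic (ε-atomic (∁ᵣ q₀)) (ε-atomic (∁ᵣ q₁))
      (⊑-trans (ε-mono (⊆ᵣ-trans (∩ᵣ-⊆ˡ {r = ∁ᵣ q₀}) (∁ᵣ-antitone (∪ᵣ-⊆ˡ {r = r} {r₀}))))
               (⊑-reflexive (sym (ε∥ε (∁ᵣ q₀) (∁ᵣ q₁)))))
      (⊥-min _))

    stepwise : L ⊑ (nil ⊓ (π r₁ ⊓ ε q₀) ⨾ A₀ ⊓ ε (∁ᵣ q₀) ⨾ ⊥)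
                 ∥ (nil ⊓ (π r₀ ⊓ ε q₁) ⨾ A₁ ⊓ ε (∁ᵣ q₁) ⨾ ⊥)
    stepwise = ⊑-⊓∥
      (⊑-∥⊓ L⊑nil (⊑-∥⊓ (⊑-⊤ (nil-∥-atomic _ (π⊓ε-atomic r₀ q₁)))
                         (⊑-⊤ (nil-∥-atomic _ (ε-atomic (∁ᵣ q₁))))))
      (⊑-⊓∥
        (⊑-∥⊓ (⊑-⊤ (atomic-∥-nil _ _ (π⊓ε-atomic r₁ q₀))) (⊑-∥⊓ step-step step-abort))
        (⊑-∥⊓ (⊑-⊤ (atomic-∥-nil _ _ (ε-atomic (∁ᵣ q₀)))) (⊑-∥⊓ abort-step abort-abort)))

  ⋒⊑∥ : ∀ {c d} → c ⋒ term ≡ c → c ∥ term ≡ c → d ⋒ term ≡ d → d ∥ term ≡ d → c ⋒ d ⊑ c ∥ d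
  ⋒⊑∥ {c} {d} c⋒term c∥term d⋒term d∥term = begin
    c ⋒ d                    ≡⟨ cong₂ _⋒_ (sym c∥term) (trans (sym d∥term) (∥-comm d term)) ⟩
    (c ∥ term) ⋒ (term ∥ d)  ≲⟨ interchange c term term d ⟩
    (c ⋒ term) ∥ (term ⋒ d)  ≡⟨ cong₂ _∥_ c⋒term (trans (⋒-comm term d) d⋒term) ⟩
    c ∥ d                    ∎
    where open ⊑-Reasoning

mainTheorem18 : {St : Set} (A : Algebra St) → let open Algebra A in
    (r r₀ r₁ : Rel St) (c d : Cmd) →
    c ⋒ term ≡ c → c ∥ term ≡ c →
    d ⋒ term ≡ d → d ∥ term ≡ d →
    rely r ⋒ (c ⋒ d) ⊑ (rely (r ∪ᵣ r₀) ⋒ guar r₁ ⋒ c) ∥ (rely (r ∪ᵣ r₁) ⋒ guar r₀ ⋒ d)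
mainTheorem18 A r r₀ r₁ c d c⋒term c∥term d⋒term d∥term = begin
    rely r ⋒ (c ⋒ d)
  ≲⟨ ⋒-mono (rely-split r r₀ r₁) (⋒⊑∥ c⋒term c∥term d⋒term d∥term) ⟩
    (rely (r ∪ᵣ r₀) ⋒ guar r₁ ∥ rely (r ∪ᵣ r₁) ⋒ guar r₀) ⋒ (c ∥ d)
  ≲⟨ interchange _ c _ d ⟩
    (rely (r ∪ᵣ r₀) ⋒ guar r₁) ⋒ c ∥ (rely (r ∪ᵣ r₁) ⋒ guar r₀) ⋒ d
  ≡⟨ cong₂ _∥_ (⋒-assoc _ _ c) (⋒-assoc _ _ d) ⟩
    rely (r ∪ᵣ r₀) ⋒ guar r₁ ⋒ c ∥ rely (r ∪ᵣ r₁) ⋒ guar r₀ ⋒ d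
  ∎
  where
  open Algebra A
  open Laws A
  open ⊑-Reasoning
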